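{- Let $(\mathcal{L},\mathcal{G})$ be a built lattice and let $X_1\le X_2\le X_3\le X_4$ be elements of $\mathcal{L}$. Then $$\mathrm{Ind}_{[X_2,X_3]}\big(\mathrm{Ind}_{[X_1,X_4]}(\mathcal{G})\big)=\mathrm{Ind}_{[X_2,X_3]}(\mathcal{G}).$$
   Context: A finite lattice $\mathcal{L}$ (with bottom $\hat 0$ and top $\hat 1$) is geometric if all maximal chains between two comparable elements have the same length, the resulting rank function $\rho$ (with $\rho(\hat0)=0$) satisfies $\rho(X\wedge Y)+\rho(X\vee Y)\le\rho(X)+\rho(Y)$, and every element is a join of atoms; every interval of a geometric lattice is geometric. A building set of a geometric lattice $\mathcal{L}$ is a subset $\mathcal{G}\subset\mathcal{L}\setminus\{\hat0\}$ such that for every $X\in\mathcal{L}$, denoting by $\mathrm{Fact}_{\mathcal{G}}(X)$ the set of maximal elements of $\mathcal{G}\cap[\hat0,X]$, the join map $\prod_{G\in\mathrm{Fact}_{\mathcal{G}}(X)}[\hat0,G]\to[\hat0,X]$ is a poset isomorphism. A built lattice is a pair $(\mathcal{L},\mathcal{G})$ of a geometric lattice and a building set. For $G_1\le G_2$ in $\mathcal{L}$, the induced building set is $\mathrm{Ind}_{[G_1,G_2]}(\mathcal{G})=\big(\{G_1\vee G: G\in\mathcal{G}\}\cap[G_1,G_2]\big)\setminus\{G_1\}$; it is a building set of $[G_1,G_2]$ (when $G_1<G_2$). In the left-hand side, the outer induction is performed in the built lattice $([X_1,X_4],\mathrm{Ind}_{[X_1,X_4]}(\mathcal{G}))$. 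-}

module Defs where

open import Level using (Level; _⊔_) renaming (suc to lsuc)
open import Data.Nat using (ℕ; zero; suc; _+_; _≤_)
open import Data.Fin using (Fin) renaming (zero to fz; suc to fs)
open import Data.List using (List; length; lookup; foldr)
open import Data.List.Relation.Unary.All using (All)
open import Data.List.Relation.Unary.Any using (Any)
open import Data.Product using (Σ; ∃; _×_; _,_; proj₁; proj₂)
open import Data.Sum using (_⊎_)
open import Relation.Nullary using (¬_)
open import Relation.Unary using (Pred)
open import Relation.Binary.PropositionalEquality using (_≡_)
open import Relation.Binary.Lattice.Bundles using (BoundedLattice)
open import Relation.Binary.Lattice.Structures using (IsBoundedLattice; IsLattice)
import Relation.Binary.Construct.On as On
open import Function using (_⇔_)

module _ {c ℓ₁ ℓ₂ : Level} (L : BoundedLattice c ℓ₁ ℓ₂) where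
  open BoundedLattice L renaming (_≤_ to _≼_)

  _≺_ : Carrier → Carrier → Set (ℓ₁ ⊔ ℓ₂)
  x ≺ y = x ≼ y × ¬ (x ≈ y)

  Covers : Carrier → Carrier → Set (c ⊔ ℓ₁ ⊔ ℓ₂)
  Covers x y = x ≺ y × (∀ z → x ≼ z → z ≼ y → z ≈ x ⊎ z ≈ y)

  data MaxChain : Carrier → Carrier → ℕ → Set (c ⊔ ℓ₁ ⊔ ℓ₂) where
    done : ∀ {x y} → x ≈ y → MaxChain x y zero
    step : ∀ {x z y k} → Covers x z → MaxChain z y k → MaxChain x y (suc k)

  Rank : Carrier → ℕ → Set (c ⊔ ℓ₁ ⊔ ℓ₂)
  Rank x k = MaxChain ⊥ x k

  IsAtom : Carrier → Set (c ⊔ ℓ₁ ⊔ ℓ₂)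
  IsAtom a = Covers ⊥ a

  IsFinite : Set (c ⊔ ℓ₁)
  IsFinite = Σ (List Carrier) λ xs → ∀ x → Any (x ≈_) xs

  record IsGeometric : Set (c ⊔ ℓ₁ ⊔ ℓ₂) where
    field
      finite      : IsFinite
      graded      : ∀ x y m n → MaxChain x y m → MaxChain x y n → m ≡ n
      semimodular : ∀ X Y a b p q → Rank (X ∧ Y) a → Rank (X ∨ Y) b →
                    Rank X p → Rank Y q → a + b ≤ p + q
      atomistic   : ∀ X → Σ (List Carrier) λ as → All IsAtom as × X ≈ foldr _∨_ ⊥ as

  ⋁ : (n : ℕ) → (Fin n → Carrier) → Carrier
  ⋁ zero    y = ⊥
  ⋁ (suc n) y = y fz ∨ ⋁ n (λ i → y (fs i))

  module _ {ℓ : Level} (G : Pred Carrier ℓ) where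

    InFact : Carrier → Carrier → Set (c ⊔ ℓ₁ ⊔ ℓ₂ ⊔ ℓ)
    InFact X F = G F × F ≼ X × (∀ F' → G F' → F' ≼ X → F ≼ F' → F' ≈ F)

    EnumeratesFact : Carrier → List Carrier → Set (c ⊔ ℓ₁ ⊔ ℓ₂ ⊔ ℓ)
    EnumeratesFact X Fs =
      (∀ i → InFact X (lookup Fs i)) ×
      (∀ F → InFact X F → Σ (Fin (length Fs)) λ i → F ≈ lookup Fs i) ×
      (∀ i j → lookup Fs i ≈ lookup Fs j → i ≡ j)

    -- the join map ∏_{F ∈ Fs} [⊥, F] → [⊥, X] is a poset isomorphism
    -- (surjective onto [⊥, X] and an order embedding)
    JoinMapIso : Carrier → List Carrier → Set (c ⊔ ℓ₁ ⊔ ℓ₂)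
    JoinMapIso X Fs =
      (∀ Y → Y ≼ X → Σ (Fin (length Fs) → Carrier) λ y →
          (∀ i → y i ≼ lookup Fs i) × ⋁ (length Fs) y ≈ Y) ×
      (∀ (y y' : Fin (length Fs) → Carrier) →
          (∀ i → y i ≼ lookup Fs i) → (∀ i → y' i ≼ lookup Fs i) →
          (⋁ (length Fs) y ≼ ⋁ (length Fs) y' ⇔ (∀ i → y i ≼ y' i)))

    record IsBuildingSet : Set (c ⊔ ℓ₁ ⊔ ℓ₂ ⊔ ℓ) where
      field
        respects : ∀ {x y} → x ≈ y → G x → G y
        nonzero  : ∀ g → G g → ¬ (g ≈ ⊥)
        factor   : ∀ X → Σ (List Carrier) λ Fs → EnumeratesFact X Fs × JoinMapIso X Fs

    Ind : Carrier → Carrier → Pred Carrier (c ⊔ ℓ₁ ⊔ ℓ₂ ⊔ ℓ)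
    Ind G₁ G₂ Y = (Σ Carrier λ g → G g × Y ≈ G₁ ∨ g) × G₁ ≼ Y × Y ≼ G₂ × ¬ (Y ≈ G₁)

  interval : (a b : Carrier) → a ≼ b → BoundedLattice (c ⊔ ℓ₂) ℓ₁ ℓ₂
  interval a b a≤b = record
    { Carrier = Σ Carrier (λ y → a ≼ y × y ≼ b)
    ; _≈_ = λ x y → proj₁ x ≈ proj₁ y
    ; _≤_ = λ x y → proj₁ x ≼ proj₁ y
    ; _∨_ = join
    ; _∧_ = meet
    ; ⊤ = b , a≤b , refl
    ; ⊥ = a , refl , a≤b
    ; isBoundedLattice = record
      { isLattice = record
        { isPartialOrder = On.isPartialOrder proj₁ isPartialOrder
        ; supremum = λ x y → let (p , q , r) = supremum (proj₁ x) (proj₁ y) in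
                       p , q , λ z → r (proj₁ z)
        ; infimum = λ x y → let (p , q , r) = infimum (proj₁ x) (proj₁ y) in
                       p , q , λ z → r (proj₁ z)
        }
      ; maximum = λ x → proj₂ (proj₂ x)
      ; minimum = λ x → proj₁ (proj₂ x)
      }
    }
    where
    I = Σ Carrier (λ y → a ≼ y × y ≼ b)
    join : I → I → I
    join (x , ax , xb) (y , ay , yb) =
      let (p , q , r) = supremum x y in (x ∨ y) , trans ax p , r b xb yb
    meet : I → I → I
    meet (x , ax , xb) (y , ay , yb) =
      let (p , q , r) = infimum x y in (x ∧ y) , r a ax ay , trans p xb

module Submission where

open import Defs
open import Level using (Level; _⊔_)
open import Data.Product using (_×_; _,_; proj₁)
open import Relation.Unary using (Pred)
open import Relation.Binary.Lattice.Bundles using (BoundedLattice; JoinSemilattice)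
open import Function using (_⇔_)
open import Function.Bundles using (mk⇔)
open import Relation.Nullary using (¬_)
import Relation.Binary.Lattice.Properties.JoinSemilattice as JoinSemilatticeProperties

-- Ind_{[X₂,X₃]} only sees G through the joins X₂ ∨ g, and X₂ ∨ (X₁ ∨ g) = X₂ ∨ g
-- because X₁ ≤ X₂; so an element X₁ ∨ g of the outer induced set contributes exactly
-- what g itself contributes.  The only care needed is that X₁ ∨ g ≠ X₁ whenever
-- X₂ ∨ g ≠ X₂.

module _ {c ℓ₁ ℓ₂ : Level} (J : JoinSemilattice c ℓ₁ ℓ₂) where
  open JoinSemilattice J
  open JoinSemilatticeProperties J

  x≤y⇒y∨[x∨z]≈y∨z : ∀ {x y z} → x ≤ y → y ∨ (x ∨ z) ≈ y ∨ z
  x≤y⇒y∨[x∨z]≈y∨z {x} {y} {z} x≤y = Eq.trans (Eq.sym (∨-assoc y x z))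
    (∨-cong (Eq.trans (∨-comm y x) (x≤y⇒x∨y≈y x≤y)) Eq.refl)

  x∨y≈x⇒y≤x : ∀ {x y} → x ∨ y ≈ x → y ≤ x
  x∨y≈x⇒y≤x {x} {y} e = trans (y≤x∨y x y) (reflexive e)

  x≤y⇒y∨z≉y⇒x∨z≉x : ∀ {x y z} → x ≤ y → ¬ (y ∨ z ≈ y) → ¬ (x ∨ z ≈ x)
  x≤y⇒y∨z≉y⇒x∨z≉x {x} {y} {z} x≤y y∨z≉y x∨z≈x =
    y∨z≉y (Eq.trans (∨-comm y z) (x≤y⇒x∨y≈y (trans (x∨y≈x⇒y≤x x∨z≈x) x≤y)))

module _ {c ℓ₁ ℓ₂ ℓ : Level} (L : BoundedLattice c ℓ₁ ℓ₂) (G : Pred (BoundedLattice.Carrier L) ℓ) where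
  open BoundedLattice L
  open JoinSemilatticeProperties joinSemilattice using (∨-cong)

  Ind-bounds : ∀ {X₁ X₂ X₃ X₄ Y} → X₁ ≤ X₂ → X₃ ≤ X₄ →
               Ind L G X₂ X₃ Y → X₁ ≤ Y × Y ≤ X₄
  Ind-bounds X₁≤X₂ X₃≤X₄ (_ , X₂≤Y , Y≤X₃ , _) = trans X₁≤X₂ X₂≤Y , trans Y≤X₃ X₃≤X₄

  module _ {X₁ X₂ X₃ X₄ : Carrier} (p₁₂ : X₁ ≤ X₂) (p₂₃ : X₂ ≤ X₃) (p₃₄ : X₃ ≤ X₄) where
    private
      I : BoundedLattice (c ⊔ ℓ₂) ℓ₁ ℓ₂
      I = interval L X₁ X₄ (trans p₁₂ (trans p₂₃ p₃₄))
      Ind² : Pred (BoundedLattice.Carrier I) (c ⊔ ℓ₁ ⊔ ℓ₂ ⊔ ℓ)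
      Ind² = Ind I (λ Z → Ind L G X₁ X₄ (proj₁ Z))
               (X₂ , p₁₂ , trans p₂₃ p₃₄) (X₃ , trans p₁₂ p₂₃ , p₃₄)

    Ind-Ind⇒Ind : ∀ Y → Ind² Y → Ind L G X₂ X₃ (proj₁ Y)
    Ind-Ind⇒Ind Y ((Z , ((g , Gg , Z≈X₁∨g) , _) , Y≈X₂∨Z) , X₂≤Y , Y≤X₃ , Y≉X₂) =
      (g , Gg , Eq.trans Y≈X₂∨Z (Eq.trans (∨-cong Eq.refl Z≈X₁∨g) (x≤y⇒y∨[x∨z]≈y∨z joinSemilattice p₁₂)))
      , X₂≤Y , Y≤X₃ , Y≉X₂

    Ind⇒Ind-Ind : ∀ Y → Ind L G X₂ X₃ (proj₁ Y) → Ind² Y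
    Ind⇒Ind-Ind Y ((g , Gg , Y≈X₂∨g) , X₂≤Y , Y≤X₃ , Y≉X₂) =
      (Z , ((g , Gg , Eq.refl) , X₁≤X₁∨g , X₁∨g≤X₄ , X₁∨g≉X₁) , Y≈X₂∨Z) , X₂≤Y , Y≤X₃ , Y≉X₂
      where
      X₁≤X₁∨g : X₁ ≤ X₁ ∨ g
      X₁≤X₁∨g = x≤x∨y X₁ g
      X₁∨g≤X₄ : X₁ ∨ g ≤ X₄
      X₁∨g≤X₄ = ∨-least (trans p₁₂ (trans p₂₃ p₃₄))
        (trans (y≤x∨y X₂ g) (trans (reflexive (Eq.sym Y≈X₂∨g)) (trans Y≤X₃ p₃₄)))
      X₁∨g≉X₁ : ¬ (X₁ ∨ g ≈ X₁)
      X₁∨g≉X₁ = x≤y⇒y∨z≉y⇒x∨z≉x joinSemilattice p₁₂ (λ X₂∨g≈X₂ → Y≉X₂ (Eq.trans Y≈X₂∨g X₂∨g≈X₂))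
      Z : BoundedLattice.Carrier I
      Z = X₁ ∨ g , X₁≤X₁∨g , X₁∨g≤X₄
      Y≈X₂∨Z : proj₁ Y ≈ X₂ ∨ (X₁ ∨ g)
      Y≈X₂∨Z = Eq.trans Y≈X₂∨g (Eq.sym (x≤y⇒y∨[x∨z]≈y∨z joinSemilattice p₁₂))

mainTheorem1 : {c ℓ₁ ℓ₂ ℓ : Level} (L : BoundedLattice c ℓ₁ ℓ₂)
  (G : Pred (BoundedLattice.Carrier L) ℓ) →
  IsGeometric L → IsBuildingSet L G →
  let open BoundedLattice L in
  (X₁ X₂ X₃ X₄ : Carrier) (p₁₂ : X₁ ≤ X₂) (p₂₃ : X₂ ≤ X₃) (p₃₄ : X₃ ≤ X₄) →
  let p₂₄ = trans p₂₃ p₃₄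
      p₁₃ = trans p₁₂ p₂₃
      p₁₄ = trans p₁₂ p₂₄
      I = interval L X₁ X₄ p₁₄
  in
  ((Y : BoundedLattice.Carrier I) →
    Ind I (λ Z → Ind L G X₁ X₄ (proj₁ Z)) (X₂ , p₁₂ , p₂₄) (X₃ , p₁₃ , p₃₄) Y
      ⇔ Ind L G X₂ X₃ (proj₁ Y))
  × ((Y : Carrier) → Ind L G X₂ X₃ Y → X₁ ≤ Y × Y ≤ X₄)
mainTheorem1 L G _ _ X₁ X₂ X₃ X₄ p₁₂ p₂₃ p₃₄ =
  (λ Y → mk⇔ (Ind-Ind⇒Ind L G p₁₂ p₂₃ p₃₄ Y) (Ind⇒Ind-Ind L G p₁₂ p₂₃ p₃₄ Y))
  , λ _ → Ind-bounds L G p₁₂ p₃₄
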